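{- Let $n\ge 2$ and $N=p_1p_2\cdots p_n$ a product of $n$ distinct primes. Then the rational function $P_N(x)$ is a polynomial with integer coefficients.
   Context: For indices $i_1,\dots,i_m\in[n]$ write $N_{i_1\cdots i_m}=N/(p_{i_1}\cdots p_{i_m})$, and $$P_N(x)=\frac{(1-x^N)\prod_{1\le i<j\le n}(1-x^{N_{ij}})}{\prod_{i=1}^n(1-x^{N_i})}.$$ -}

module Defs where

open import Data.Nat using (ℕ; zero; suc; _≡ᵇ_; _<ᵇ_; NonZero)
  renaming (_+_ to _+ℕ_; _*_ to _*ℕ_; _∸_ to _∸ℕ_; _<_ to _<ℕ_)
open import Data.Nat.Properties using (m*n≢0)
open import Data.Nat.DivMod using (_/_)
open import Data.Nat.Primality using (Prime; prime⇒nonZero)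
open import Data.Integer using (ℤ; 0ℤ; 1ℤ; _+_; _*_; _-_)
open import Data.Fin using (Fin; toℕ)
open import Data.Bool using (if_then_else_)
open import Data.Product using (∃-syntax)
open import Relation.Binary.PropositionalEquality using (_≡_)

Series : Set
Series = ℕ → ℤ

IsPolynomial : Series → Set
IsPolynomial f = ∃[ d ] (∀ k → d <ℕ k → f k ≡ 0ℤ)

sumUpTo : (ℕ → ℤ) → ℕ → ℤ
sumUpTo g zero = g zero
sumUpTo g (suc k) = sumUpTo g k + g (suc k)

_⊛_ : Series → Series → Series
(f ⊛ g) k = sumUpTo (λ i → f i * g (k ∸ℕ i)) k

one : Series
one k = if k ≡ᵇ 0 then 1ℤ else 0ℤ

xPow : ℕ → Series
xPow m k = if k ≡ᵇ m then 1ℤ else 0ℤ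

oneMinusXPow : ℕ → Series
oneMinusXPow m k = one k - xPow m k

∏ₛ : ∀ n → (Fin n → Series) → Series
∏ₛ zero f = one
∏ₛ (suc n) f = f Fin.zero ⊛ ∏ₛ n (λ i → f (Fin.suc i))

∏ℕ : ∀ n → (Fin n → ℕ) → ℕ
∏ℕ zero f = 1
∏ℕ (suc n) f = f Fin.zero *ℕ ∏ℕ n (λ i → f (Fin.suc i))

module _ {n : ℕ} (p : Fin n → ℕ) (pr : ∀ i → Prime (p i)) where

  bigN : ℕ
  bigN = ∏ℕ n p

  bigNᵢ : Fin n → ℕ
  bigNᵢ i = (bigN / p i) {{prime⇒nonZero (pr i)}}

  bigNᵢⱼ : Fin n → Fin n → ℕ
  bigNᵢⱼ i j = (bigN / (p i *ℕ p j))
    {{m*n≢0 (p i) (p j) {{prime⇒nonZero (pr i)}} {{prime⇒nonZero (pr j)}}}}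

  numerator : Series
  numerator = oneMinusXPow bigN ⊛
    ∏ₛ n (λ i → ∏ₛ n (λ j →
      if toℕ i <ᵇ toℕ j then oneMinusXPow (bigNᵢⱼ i j) else one))

  denominator : Series
  denominator = ∏ₛ n (λ i → oneMinusXPow (bigNᵢ i))

-- P_N(x) is a polynomial Q with integer coefficients: Q · denominator = numerator
-- (the denominator has constant term 1, so this determines P_N uniquely).
PNIsIntegerPolynomial : ∀ {n} (p : Fin n → ℕ) (pr : ∀ i → Prime (p i)) → Set
PNIsIntegerPolynomial p pr =
  ∃[ Q ] (IsPolynomial Q × (∀ k → (Q ⊛ denominator p pr) k ≡ numerator p pr k))
  where open import Data.Product using (_×_)

{-# OPTIONS --safe #-}
-- We prove more generally that P_N(x^m) is a polynomial for every m ≥ 1, by induction on n.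
-- Split N = p₀ M with M = p₁ ⋯ pₙ₋₁ and Mⱼ = M / pⱼ. Comparing factors, the numerator of
-- P_N(x^m) is that of P_M(x^(m p₀)) times E = ∏ⱼ (1 - x^(m Mⱼ)), and the denominator of
-- P_N(x^m) is that of P_M(x^(m p₀)) times 1 - x^(m M); so P_N(x^m) = P_M(x^(m p₀)) E / (1 - x^(m M)),
-- a power series with integer coefficients. Multiplying P_M(x^(m p₀)) E by the geometric sums
-- Gⱼ = (1 - x^(m p₀ Mⱼ)) / (1 - x^(m Mⱼ)) recovers the numerator of P_M(x^(m p₀)), which
-- contains the factor 1 - x^(m p₀ M) and hence 1 - x^(m M). Each Gⱼ is coprime to 1 - x^(m M)
-- up to the constant p₀: with b = m Mⱼ, Bézout for the coprime p₀, pⱼ puts 1 - x^b into the ideal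
-- (1 - x^(p₀ b), 1 - x^(pⱼ b)) ⊆ (Gⱼ, 1 - x^(m M)), and Gⱼ ≡ p₀ modulo 1 - x^b. Cancelling the Gⱼ
-- one at a time shows that 1 - x^(m M) divides p₀ⁿ⁻¹ P_M(x^(m p₀)) E in ℤ[x], so p₀ⁿ⁻¹ P_N(x^m)
-- is a polynomial and therefore so is P_N(x^m).

module Submission where

open import Defs
open import Level using (0ℓ)
open import Algebra.Bundles using (CommutativeRing)
import Algebra.Construct.Pointwise as Pointwise
import Algebra.Properties.CommutativeSemigroup as CommutativeSemigroupProperties
import Algebra.Properties.Ring as RingProperties
import Algebra.Solver.Ring as RingSolver
open import Algebra.Solver.Ring.AlmostCommutativeRing
  using (fromCommutativeRing; _-Raw-AlmostCommutative⟶_; Induced-equivalence)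
open import Data.Bool using (Bool; true; false; T; if_then_else_)
open import Data.Empty using (⊥-elim)
open import Data.Fin using (Fin; zero; suc; toℕ)
import Data.Fin.Properties as Fin
open import Data.Integer as ℤ using (ℤ; 0ℤ; 1ℤ; _+_; _*_; -_; _-_)
import Data.Integer.Properties as ℤ
open import Data.Maybe using (just; nothing)
open import Data.Nat as ℕ using (ℕ; zero; suc; _≤_; _<_; z≤n; s≤s; _∸_; _≡ᵇ_; _<ᵇ_; _≤?_; NonZero)
open import Data.Nat.Coprimality as Coprime using (Coprime; coprime-Bézout)
open import Data.Nat.DivMod using (m*n/n≡m; *-/-assoc; m*n/m*o≡n/o; /-congˡ; m/n*n≡m)
open import Data.Nat.Divisibility
  using (_∣_; _∣?_; ∣m+n∣m⇒∣n; ∣m∣n⇒∣m+n; ∣-refl; _∣0; ∣⇒≤; *-monoʳ-∣; ∣n⇒∣m*n; ∣m⇒∣m*n)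
open import Data.Nat.GCD using (module Bézout)
open import Data.Nat.Primality using (Prime; prime⇒nonZero; prime⇒irreducible; prime⇒nonTrivial)
import Data.Nat.Properties as ℕ
open import Data.Nat.Tactic.RingSolver using () renaming (solve-∀ to ℕ-solve-∀)
open import Data.Product using (_,_)
open import Data.Sum using (inj₁; inj₂)
open import Data.Unit using (tt)
open import Function using (_∘_)
open import Function.Definitions using (Injective)
open import Relation.Binary.Definitions using (WeaklyDecidable)
open import Relation.Binary.PropositionalEquality
import Relation.Binary.Reasoning.Setoid as SetoidReasoning
open import Relation.Nullary using (yes; no)

sumUpTo-cong : ∀ {g h} k → (∀ i → i ≤ k → g i ≡ h i) → sumUpTo g k ≡ sumUpTo h k
sumUpTo-cong zero    e = e 0 z≤n
sumUpTo-cong (suc k) e =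
  cong₂ _+_ (sumUpTo-cong k (λ i i≤k → e i (ℕ.m≤n⇒m≤1+n i≤k))) (e (suc k) ℕ.≤-refl)

sumUpTo-zero : ∀ g k → (∀ i → i ≤ k → g i ≡ 0ℤ) → sumUpTo g k ≡ 0ℤ
sumUpTo-zero g zero    e = e 0 z≤n
sumUpTo-zero g (suc k) e =
  cong₂ _+_ (sumUpTo-zero g k (λ i i≤k → e i (ℕ.m≤n⇒m≤1+n i≤k))) (e (suc k) ℕ.≤-refl)

sumUpTo-single : ∀ g a k → a ≤ k → (∀ i → i ≢ a → g i ≡ 0ℤ) → sumUpTo g k ≡ g a
sumUpTo-single g a zero    z≤n _ = refl
sumUpTo-single g a (suc k) a≤ e with ℕ.m≤n⇒m<n∨m≡n a≤
... | inj₁ (s≤s a≤k) = begin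
  sumUpTo g k + g (suc k) ≡⟨ cong₂ _+_ (sumUpTo-single g a k a≤k e) (e (suc k) (ℕ.>⇒≢ (s≤s a≤k))) ⟩
  g a + 0ℤ                ≡⟨ ℤ.+-identityʳ (g a) ⟩
  g a                     ∎
  where open ≡-Reasoning
... | inj₂ refl = trans
  (cong (_+ g (suc k)) (sumUpTo-zero g k (λ i i≤k → e i (ℕ.<⇒≢ (s≤s i≤k)))))
  (ℤ.+-identityˡ (g (suc k)))

sumUpTo-+ : ∀ g h k → sumUpTo (λ i → g i + h i) k ≡ sumUpTo g k + sumUpTo h k
sumUpTo-+ g h zero    = refl
sumUpTo-+ g h (suc k) =
  trans (cong (_+ (g (suc k) + h (suc k))) (sumUpTo-+ g h k))
    (CommutativeSemigroupProperties.interchange ℤ.+-commutativeSemigroup (sumUpTo g k) _ _ _)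

sumUpTo-*ˡ : ∀ c g k → sumUpTo (λ i → c * g i) k ≡ c * sumUpTo g k
sumUpTo-*ˡ c g zero    = refl
sumUpTo-*ˡ c g (suc k) =
  trans (cong (_+ c * g (suc k)) (sumUpTo-*ˡ c g k)) (sym (ℤ.*-distribˡ-+ c (sumUpTo g k) _))

sumUpTo-*ʳ : ∀ c g k → sumUpTo (λ i → g i * c) k ≡ sumUpTo g k * c
sumUpTo-*ʳ c g k = begin
  sumUpTo (λ i → g i * c) k ≡⟨ sumUpTo-cong k (λ i _ → ℤ.*-comm (g i) c) ⟩
  sumUpTo (λ i → c * g i) k ≡⟨ sumUpTo-*ˡ c g k ⟩
  c * sumUpTo g k           ≡⟨ ℤ.*-comm c _ ⟩
  sumUpTo g k * c           ∎
  where open ≡-Reasoning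

sumUpTo-suc : ∀ g k → sumUpTo g (suc k) ≡ g 0 + sumUpTo (g ∘ suc) k
sumUpTo-suc g zero    = refl
sumUpTo-suc g (suc k) =
  trans (cong (_+ g (suc (suc k))) (sumUpTo-suc g k)) (ℤ.+-assoc (g 0) _ _)

sumUpTo-reverse : ∀ g k → sumUpTo g k ≡ sumUpTo (λ i → g (k ∸ i)) k
sumUpTo-reverse g zero    = refl
sumUpTo-reverse g (suc k) = begin
  sumUpTo g k + g (suc k)                   ≡⟨ cong (_+ g (suc k)) (sumUpTo-reverse g k) ⟩
  sumUpTo (λ i → g (k ∸ i)) k + g (suc k)   ≡⟨ ℤ.+-comm (sumUpTo (λ i → g (k ∸ i)) k) _ ⟩
  g (suc k) + sumUpTo (λ i → g (k ∸ i)) k   ≡⟨ sumUpTo-suc (λ i → g (suc k ∸ i)) k ⟨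
  sumUpTo (λ i → g (suc k ∸ i)) (suc k)     ∎
  where open ≡-Reasoning

sumUpTo-triangle : ∀ (a : ℕ → ℕ → ℤ) k →
  sumUpTo (λ i → sumUpTo (λ j → a j i) i) k ≡
  sumUpTo (λ j → sumUpTo (λ t → a j (j ℕ.+ t)) (k ∸ j)) k
sumUpTo-triangle a zero    = refl
sumUpTo-triangle a (suc k) = begin
  sumUpTo (λ i → sumUpTo (λ j → a j i) i) k + (column k + a (suc k) (suc k))
    ≡⟨ cong (_+ (column k + a (suc k) (suc k))) (sumUpTo-triangle a k) ⟩
  rows k + (column k + a (suc k) (suc k))
    ≡⟨ ℤ.+-assoc (rows k) _ _ ⟨
  (rows k + column k) + a (suc k) (suc k)
    ≡⟨ cong (_+ a (suc k) (suc k)) (sumUpTo-+ (row k) (λ j → a j (suc k)) k) ⟨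
  sumUpTo (λ j → row k j + a j (suc k)) k + a (suc k) (suc k)
    ≡⟨ cong₂ _+_ (sumUpTo-cong k extend) diagonal ⟨
  sumUpTo (row (suc k)) k + row (suc k) (suc k)
    ∎
  where
  open ≡-Reasoning
  row : ℕ → ℕ → ℤ
  row k j = sumUpTo (λ t → a j (j ℕ.+ t)) (k ∸ j)
  rows column : ℕ → ℤ
  rows k = sumUpTo (row k) k
  column k = sumUpTo (λ j → a j (suc k)) k
  diagonal : row (suc k) (suc k) ≡ a (suc k) (suc k)
  diagonal rewrite ℕ.n∸n≡0 k = cong (a (suc k)) (ℕ.+-identityʳ (suc k))
  extend : ∀ j → j ≤ k → row (suc k) j ≡ row k j + a j (suc k)
  extend j j≤k rewrite ℕ.+-∸-assoc 1 j≤k =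
    cong (λ z → row k j + a j z) (trans (ℕ.+-suc j (k ∸ j)) (cong suc (ℕ.m+[n∸m]≡n j≤k)))

infixl 6 _⊕_
_⊕_ : Series → Series → Series
(f ⊕ g) k = f k + g k

infix 30 ⊝_
⊝_ : Series → Series
(⊝ f) k = - f k

zeroₛ : Series
zeroₛ _ = 0ℤ

const : ℤ → Series
const c k = if k ≡ᵇ 0 then c else 0ℤ

⊛-cong : ∀ {f f′ g g′} → f ≗ f′ → g ≗ g′ → f ⊛ g ≗ f′ ⊛ g′
⊛-cong f≗f′ g≗g′ k = sumUpTo-cong k (λ i _ → cong₂ _*_ (f≗f′ i) (g≗g′ (k ∸ i)))

⊕-congˡ : ∀ f {g g′} → g ≗ g′ → f ⊕ g ≗ f ⊕ g′
⊕-congˡ f g≗g′ k = cong (f k +_) (g≗g′ k)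

⊕-congʳ : ∀ f {g g′} → g ≗ g′ → g ⊕ f ≗ g′ ⊕ f
⊕-congʳ f g≗g′ k = cong (_+ f k) (g≗g′ k)

⊛-congˡ : ∀ f {g g′} → g ≗ g′ → f ⊛ g ≗ f ⊛ g′
⊛-congˡ f = ⊛-cong {f} {f} (λ _ → refl)

⊛-congʳ : ∀ f {g g′} → g ≗ g′ → g ⊛ f ≗ g′ ⊛ f
⊛-congʳ f g≗g′ = ⊛-cong {g = f} {g′ = f} g≗g′ (λ _ → refl)

⊛-comm : ∀ f g → f ⊛ g ≗ g ⊛ f
⊛-comm f g k = begin
  sumUpTo (λ i → f i * g (k ∸ i)) k             ≡⟨ sumUpTo-reverse _ k ⟩
  sumUpTo (λ i → f (k ∸ i) * g (k ∸ (k ∸ i))) k ≡⟨ sumUpTo-cong k swap ⟩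
  sumUpTo (λ i → g i * f (k ∸ i)) k             ∎
  where
  open ≡-Reasoning
  swap : ∀ i → i ≤ k → f (k ∸ i) * g (k ∸ (k ∸ i)) ≡ g i * f (k ∸ i)
  swap i i≤k rewrite ℕ.m∸[m∸n]≡n i≤k = ℤ.*-comm (f (k ∸ i)) (g i)

⊛-assoc : ∀ f g h → (f ⊛ g) ⊛ h ≗ f ⊛ (g ⊛ h)
⊛-assoc f g h k = begin
  sumUpTo (λ i → sumUpTo (λ j → f j * g (i ∸ j)) i * h (k ∸ i)) k
    ≡⟨ sumUpTo-cong k (λ i _ → sumUpTo-*ʳ (h (k ∸ i)) (λ j → f j * g (i ∸ j)) i) ⟨
  sumUpTo (λ i → sumUpTo (λ j → f j * g (i ∸ j) * h (k ∸ i)) i) k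
    ≡⟨ sumUpTo-triangle (λ j i → f j * g (i ∸ j) * h (k ∸ i)) k ⟩
  sumUpTo (λ j → sumUpTo (λ t → f j * g (j ℕ.+ t ∸ j) * h (k ∸ (j ℕ.+ t))) (k ∸ j)) k
    ≡⟨ sumUpTo-cong k (λ j _ → trans (sumUpTo-cong (k ∸ j) (λ t _ → reindex j t))
                                     (sumUpTo-*ˡ (f j) (λ t → g t * h (k ∸ j ∸ t)) (k ∸ j))) ⟩
  sumUpTo (λ j → f j * sumUpTo (λ t → g t * h (k ∸ j ∸ t)) (k ∸ j)) k
    ∎
  where
  open ≡-Reasoning
  reindex : ∀ j t → f j * g (j ℕ.+ t ∸ j) * h (k ∸ (j ℕ.+ t)) ≡ f j * (g t * h (k ∸ j ∸ t))
  reindex j t rewrite ℕ.m+n∸m≡n j t | ℕ.∸-+-assoc k j t = ℤ.*-assoc (f j) (g t) _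

⊛-distribˡ-⊕ : ∀ f g h → f ⊛ (g ⊕ h) ≗ f ⊛ g ⊕ f ⊛ h
⊛-distribˡ-⊕ f g h k =
  trans (sumUpTo-cong k (λ i _ → ℤ.*-distribˡ-+ (f i) (g (k ∸ i)) (h (k ∸ i)))) (sumUpTo-+ _ _ k)

⊛-distribʳ-⊕ : ∀ f g h → (g ⊕ h) ⊛ f ≗ g ⊛ f ⊕ h ⊛ f
⊛-distribʳ-⊕ f g h k = begin
  ((g ⊕ h) ⊛ f) k         ≡⟨ ⊛-comm (g ⊕ h) f k ⟩
  (f ⊛ (g ⊕ h)) k         ≡⟨ ⊛-distribˡ-⊕ f g h k ⟩
  (f ⊛ g) k + (f ⊛ h) k   ≡⟨ cong₂ _+_ (⊛-comm f g k) (⊛-comm f h k) ⟩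
  (g ⊛ f) k + (h ⊛ f) k   ∎
  where open ≡-Reasoning

xPow-diagonal : ∀ a → xPow a a ≡ 1ℤ
xPow-diagonal zero    = refl
xPow-diagonal (suc a) = xPow-diagonal a

xPow-off : ∀ a {i} → i ≢ a → xPow a i ≡ 0ℤ
xPow-off a {i} i≢a with i ≡ᵇ a in eq
... | true  = ⊥-elim (i≢a (ℕ.≡ᵇ⇒≡ i a (subst T (sym eq) tt)))
... | false = refl

xPow-⊛-< : ∀ a f {k} → k < a → (xPow a ⊛ f) k ≡ 0ℤ
xPow-⊛-< a f {k} k<a = sumUpTo-zero _ k λ i i≤k →
  trans (cong (_* f (k ∸ i)) (xPow-off a (ℕ.<⇒≢ (ℕ.≤-<-trans i≤k k<a)))) (ℤ.*-zeroˡ (f (k ∸ i)))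

xPow-⊛-+ : ∀ a f k → (xPow a ⊛ f) (a ℕ.+ k) ≡ f k
xPow-⊛-+ a f k = begin
  (xPow a ⊛ f) (a ℕ.+ k)       ≡⟨ sumUpTo-single _ a (a ℕ.+ k) (ℕ.m≤m+n a k) off ⟩
  xPow a a * f (a ℕ.+ k ∸ a)   ≡⟨ cong₂ _*_ (xPow-diagonal a) (cong f (ℕ.m+n∸m≡n a k)) ⟩
  1ℤ * f k                     ≡⟨ ℤ.*-identityˡ (f k) ⟩
  f k                          ∎
  where
  open ≡-Reasoning
  off : ∀ i → i ≢ a → xPow a i * f (a ℕ.+ k ∸ i) ≡ 0ℤ
  off i i≢a = trans (cong (_* f (a ℕ.+ k ∸ i)) (xPow-off a i≢a)) (ℤ.*-zeroˡ (f (a ℕ.+ k ∸ i)))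

⊛-identityˡ : ∀ f → one ⊛ f ≗ f
⊛-identityˡ = xPow-⊛-+ 0

⊛-identityʳ : ∀ f → f ⊛ one ≗ f
⊛-identityʳ f k = trans (⊛-comm f one k) (⊛-identityˡ f k)

seriesRing : CommutativeRing 0ℓ 0ℓ
seriesRing = record
  { Carrier = Series ; _≈_ = _≗_ ; _+_ = _⊕_ ; _*_ = _⊛_ ; -_ = ⊝_ ; 0# = zeroₛ ; 1# = one
  ; isCommutativeRing = record
    { isRing = record
      { +-isAbelianGroup = Pointwise.isAbelianGroup ℕ ℤ.+-0-isAbelianGroup
      ; *-cong = ⊛-cong
      ; *-assoc = ⊛-assoc
      ; *-identity = ⊛-identityˡ , ⊛-identityʳ
      ; distrib = ⊛-distribˡ-⊕ , ⊛-distribʳ-⊕ }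
    ; *-comm = ⊛-comm } }

open CommutativeRing seriesRing using ()
  renaming ( refl to ≗-refl; sym to ≗-sym; trans to ≗-trans; setoid to seriesSetoid
           ; +-cong to ⊕-cong; -‿cong to ⊝-cong )

module ≗-Reasoning = SetoidReasoning seriesSetoid
open RingProperties (CommutativeRing.ring seriesRing) using (-‿distribˡ-*)

const-⊛ : ∀ c f k → (const c ⊛ f) k ≡ c * f k
const-⊛ c f zero    = refl
const-⊛ c f (suc k) = begin
  (const c ⊛ f) (suc k)                                     ≡⟨ sumUpTo-suc _ k ⟩
  c * f (suc k) + sumUpTo (λ i → 0ℤ * f (k ∸ i)) k          ≡⟨ cong (c * f (suc k) +_) vanish ⟩
  c * f (suc k) + 0ℤ                                        ≡⟨ ℤ.+-identityʳ _ ⟩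
  c * f (suc k)                                             ∎
  where
  open ≡-Reasoning
  vanish = sumUpTo-zero _ k (λ i _ → ℤ.*-zeroˡ (f (k ∸ i)))

constHomomorphism : ℤ.+-*-rawRing -Raw-AlmostCommutative⟶ fromCommutativeRing seriesRing
constHomomorphism = record
  { ⟦_⟧    = const
  ; +-homo = λ c d → λ { zero → refl ; (suc k) → refl }
  ; *-homo = λ c d k → sym (trans (const-⊛ c (const d) k) (homo-* c d k))
  ; -‿homo = λ c → λ { zero → refl ; (suc k) → refl }
  ; 0-homo = λ { zero → refl ; (suc k) → refl }
  ; 1-homo = λ { zero → refl ; (suc k) → refl }
  }
  where
  homo-* : ∀ c d k → c * const d k ≡ const (c * d) k
  homo-* c d zero    = refl
  homo-* c d (suc k) = ℤ.*-zeroʳ c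

const-* : ∀ c d → const (c * d) ≗ const c ⊛ const d
const-* = _-Raw-AlmostCommutative⟶_.*-homo constHomomorphism

const-≟ : WeaklyDecidable (Induced-equivalence constHomomorphism)
const-≟ c d with c ℤ.≟ d
... | yes refl = just ≗-refl
... | no _     = nothing

open RingSolver ℤ.+-*-rawRing (fromCommutativeRing seriesRing) constHomomorphism const-≟
  using (solve; _:=_; _:+_; _:*_; :-_; con)

oneMinusXPow-cong : ∀ {a b} → a ≡ b → oneMinusXPow a ≗ oneMinusXPow b
oneMinusXPow-cong refl = ≗-refl

xPow-+ : ∀ a b → xPow a ⊛ xPow b ≗ xPow (a ℕ.+ b)
xPow-+ a b k with a ≤? k
... | yes a≤k = begin
  (xPow a ⊛ xPow b) k                 ≡⟨ cong (xPow a ⊛ xPow b) (ℕ.m+[n∸m]≡n a≤k) ⟨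
  (xPow a ⊛ xPow b) (a ℕ.+ (k ∸ a))   ≡⟨ xPow-⊛-+ a (xPow b) (k ∸ a) ⟩
  xPow b (k ∸ a)                      ≡⟨ shift a ⟨
  xPow (a ℕ.+ b) (a ℕ.+ (k ∸ a))      ≡⟨ cong (xPow (a ℕ.+ b)) (ℕ.m+[n∸m]≡n a≤k) ⟩
  xPow (a ℕ.+ b) k                    ∎
  where
  open ≡-Reasoning
  shift : ∀ c → xPow (c ℕ.+ b) (c ℕ.+ (k ∸ a)) ≡ xPow b (k ∸ a)
  shift zero    = refl
  shift (suc c) = shift c
... | no a≰k = trans (xPow-⊛-< a (xPow b) (ℕ.≰⇒> a≰k))
  (sym (xPow-off (a ℕ.+ b) λ k≡a+b → a≰k (subst (a ≤_) (sym k≡a+b) (ℕ.m≤m+n a b))))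

oneMinusXPow-+ : ∀ a c → oneMinusXPow (a ℕ.+ c) ≗ oneMinusXPow a ⊕ xPow a ⊛ oneMinusXPow c
oneMinusXPow-+ a c = begin
  one ⊕ ⊝ xPow (a ℕ.+ c)                              ≈⟨ ⊕-congˡ one (⊝-cong (xPow-+ a c)) ⟨
  one ⊕ ⊝ (xPow a ⊛ xPow c)                           ≈⟨ expand (xPow a) (xPow c) ⟩
  (one ⊕ ⊝ xPow a) ⊕ xPow a ⊛ (one ⊕ ⊝ xPow c)        ∎
  where
  open ≗-Reasoning
  expand : ∀ y z → one ⊕ ⊝ (y ⊛ z) ≗ (one ⊕ ⊝ y) ⊕ y ⊛ (one ⊕ ⊝ z)
  expand = solve 2 (λ y z → con 1ℤ :+ :- (y :* z) := (con 1ℤ :+ :- y) :+ y :* (con 1ℤ :+ :- z)) ≗-refl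

geometricSum : ℕ → ℕ → Series
geometricSum zero    b = zeroₛ
geometricSum (suc k) b = geometricSum k b ⊕ xPow (k ℕ.* b)

oneMinusXPow-⊛-geometricSum : ∀ k b → oneMinusXPow b ⊛ geometricSum k b ≗ oneMinusXPow (k ℕ.* b)
oneMinusXPow-⊛-geometricSum zero    b k =
  trans (sumUpTo-zero _ k (λ i _ → ℤ.*-zeroʳ (oneMinusXPow b i))) (sym (ℤ.+-inverseʳ (one k)))
oneMinusXPow-⊛-geometricSum (suc k) b = begin
  oneMinusXPow b ⊛ (geometricSum k b ⊕ xPow (k ℕ.* b))
    ≈⟨ ⊛-distribˡ-⊕ (oneMinusXPow b) (geometricSum k b) (xPow (k ℕ.* b)) ⟩
  oneMinusXPow b ⊛ geometricSum k b ⊕ oneMinusXPow b ⊛ xPow (k ℕ.* b)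
    ≈⟨ ⊕-cong (oneMinusXPow-⊛-geometricSum k b) (⊛-comm (oneMinusXPow b) (xPow (k ℕ.* b))) ⟩
  oneMinusXPow (k ℕ.* b) ⊕ xPow (k ℕ.* b) ⊛ oneMinusXPow b
    ≈⟨ oneMinusXPow-+ (k ℕ.* b) b ⟨
  oneMinusXPow (k ℕ.* b ℕ.+ b)
    ≈⟨ oneMinusXPow-cong (ℕ.+-comm (k ℕ.* b) b) ⟩
  oneMinusXPow (suc k ℕ.* b)
    ∎
  where open ≗-Reasoning

geometricSeries : ℕ → Series
geometricSeries b k with b ∣? k
... | yes _ = 1ℤ
... | no  _ = 0ℤ

geometricSeries-+ : ∀ b k → geometricSeries b (b ℕ.+ k) ≡ geometricSeries b k
geometricSeries-+ b k with b ∣? (b ℕ.+ k) | b ∣? k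
... | yes _   | yes _  = refl
... | no  _   | no  _  = refl
... | yes b∣b+k | no b∤k = ⊥-elim (b∤k (∣m+n∣m⇒∣n b∣b+k ∣-refl))
... | no  b∤b+k | yes b∣k = ⊥-elim (b∤b+k (∣m∣n⇒∣m+n ∣-refl b∣k))

geometricSeries-< : ∀ b k → k < b → geometricSeries b k ≡ one k
geometricSeries-< b zero    _ with b ∣? 0
... | yes _  = refl
... | no b∤0 = ⊥-elim (b∤0 (b ∣0))
geometricSeries-< b (suc k) k<b with b ∣? suc k
... | yes b∣k = ⊥-elim (ℕ.<⇒≱ k<b (∣⇒≤ b∣k))
... | no  _   = refl

oneMinusXPow-⊛-geometricSeries : ∀ b .{{_ : NonZero b}} → oneMinusXPow b ⊛ geometricSeries b ≗ one
oneMinusXPow-⊛-geometricSeries b k = begin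
  (oneMinusXPow b ⊛ geometricSeries b) k
    ≡⟨ ⊛-distribʳ-⊕ (geometricSeries b) one (⊝ xPow b) k ⟩
  (one ⊛ geometricSeries b) k + (⊝ xPow b ⊛ geometricSeries b) k
    ≡⟨ cong₂ _+_ (⊛-identityˡ (geometricSeries b) k) (sym (-‿distribˡ-* (xPow b) (geometricSeries b) k)) ⟩
  geometricSeries b k - (xPow b ⊛ geometricSeries b) k
    ≡⟨ telescope k ⟩
  one k
    ∎
  where
  open ≡-Reasoning
  g = geometricSeries b
  telescope : ∀ k → g k - (xPow b ⊛ g) k ≡ one k
  telescope k with b ≤? k
  ... | no b≰k = begin
    g k - (xPow b ⊛ g) k   ≡⟨ cong (g k +_) (cong -_ (xPow-⊛-< b g (ℕ.≰⇒> b≰k))) ⟩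
    g k + 0ℤ               ≡⟨ ℤ.+-identityʳ (g k) ⟩
    g k                    ≡⟨ geometricSeries-< b k (ℕ.≰⇒> b≰k) ⟩
    one k                  ∎
  ... | yes b≤k = begin
    g k - (xPow b ⊛ g) k                         ≡⟨ cong (λ z → g z - (xPow b ⊛ g) z) (ℕ.m+[n∸m]≡n b≤k) ⟨
    g (b ℕ.+ r) - (xPow b ⊛ g) (b ℕ.+ r)         ≡⟨ cong₂ _-_ (geometricSeries-+ b r) (xPow-⊛-+ b g r) ⟩
    g r - g r                                    ≡⟨ ℤ.+-inverseʳ (g r) ⟩
    0ℤ                                           ≡⟨ xPow-off 0 (ℕ.>⇒≢ (ℕ.<-≤-trans (ℕ.>-nonZero⁻¹ b) b≤k)) ⟨
    one k                                        ∎
    where r = k ∸ b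

∏ₛ-cong : ∀ n {f g : Fin n → Series} → (∀ i → f i ≗ g i) → ∏ₛ n f ≗ ∏ₛ n g
∏ₛ-cong zero    _   = ≗-refl
∏ₛ-cong (suc n) f≗g = ⊛-cong (f≗g zero) (∏ₛ-cong n (f≗g ∘ suc))

∏ₛ-⊛ : ∀ n (f g : Fin n → Series) → ∏ₛ n (λ i → f i ⊛ g i) ≗ ∏ₛ n f ⊛ ∏ₛ n g
∏ₛ-⊛ zero    f g = ≗-sym (⊛-identityˡ one)
∏ₛ-⊛ (suc n) f g = ≗-trans (⊛-congˡ (f zero ⊛ g zero) (∏ₛ-⊛ n (f ∘ suc) (g ∘ suc)))
  (CommutativeSemigroupProperties.interchange (CommutativeRing.*-commutativeSemigroup seriesRing)
    (f zero) (g zero) (∏ₛ n (f ∘ suc)) (∏ₛ n (g ∘ suc)))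

isPolynomial-cong : ∀ {f g} → f ≗ g → IsPolynomial f → IsPolynomial g
isPolynomial-cong f≗g (d , vanish) = d , λ k d<k → trans (sym (f≗g k)) (vanish k d<k)

isPolynomial-zero : IsPolynomial zeroₛ
isPolynomial-zero = 0 , λ _ _ → refl

isPolynomial-const : ∀ c → IsPolynomial (const c)
isPolynomial-const c = 0 , λ { (suc k) _ → refl }

isPolynomial-xPow : ∀ a → IsPolynomial (xPow a)
isPolynomial-xPow a = a , λ k a<k → xPow-off a (ℕ.>⇒≢ a<k)

isPolynomial-⊕ : ∀ {f g} → IsPolynomial f → IsPolynomial g → IsPolynomial (f ⊕ g)
isPolynomial-⊕ (d , f-vanish) (e , g-vanish) = d ℕ.+ e , λ k d+e<k →
  cong₂ _+_ (f-vanish k (ℕ.≤-<-trans (ℕ.m≤m+n d e) d+e<k)) (g-vanish k (ℕ.≤-<-trans (ℕ.m≤n+m e d) d+e<k))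

isPolynomial-⊝ : ∀ {f} → IsPolynomial f → IsPolynomial (⊝ f)
isPolynomial-⊝ (d , vanish) = d , λ k d<k → cong -_ (vanish k d<k)

isPolynomial-⊛ : ∀ {f g} → IsPolynomial f → IsPolynomial g → IsPolynomial (f ⊛ g)
isPolynomial-⊛ {f} {g} (d , f-vanish) (e , g-vanish) = d ℕ.+ e , λ k d+e<k →
  sumUpTo-zero _ k (λ i _ → term k d+e<k i)
  where
  term : ∀ k → d ℕ.+ e < k → ∀ i → f i * g (k ∸ i) ≡ 0ℤ
  term k d+e<k i with i ≤? d
  ... | no  i≰d = trans (cong (_* g (k ∸ i)) (f-vanish i (ℕ.≰⇒> i≰d))) (ℤ.*-zeroˡ (g (k ∸ i)))
  ... | yes i≤d = trans (cong (f i *_) (g-vanish (k ∸ i) e<k∸i)) (ℤ.*-zeroʳ (f i))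
    where
    e<k∸i : e < k ∸ i
    e<k∸i = ℕ.m+n≤o⇒m≤o∸n (suc e)
      (ℕ.≤-<-trans (ℕ.≤-trans (ℕ.≤-reflexive (ℕ.+-comm e i)) (ℕ.+-monoˡ-≤ e i≤d)) d+e<k)

isPolynomial-oneMinusXPow : ∀ m → IsPolynomial (oneMinusXPow m)
isPolynomial-oneMinusXPow m = isPolynomial-⊕ (isPolynomial-const 1ℤ) (isPolynomial-⊝ (isPolynomial-xPow m))

isPolynomial-geometricSum : ∀ k b → IsPolynomial (geometricSum k b)
isPolynomial-geometricSum zero    b = isPolynomial-zero
isPolynomial-geometricSum (suc k) b =
  isPolynomial-⊕ (isPolynomial-geometricSum k b) (isPolynomial-xPow (k ℕ.* b))

isPolynomial-∏ₛ : ∀ n {f : Fin n → Series} → (∀ i → IsPolynomial (f i)) → IsPolynomial (∏ₛ n f)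
isPolynomial-∏ₛ zero    _    = isPolynomial-const 1ℤ
isPolynomial-∏ₛ (suc n) poly = isPolynomial-⊛ (poly zero) (isPolynomial-∏ₛ n (poly ∘ suc))

isPolynomial-const-⊛⁻¹ : ∀ c {f} .{{_ : ℤ.NonZero c}} → IsPolynomial (const c ⊛ f) → IsPolynomial f
isPolynomial-const-⊛⁻¹ c {f} (d , vanish) = d , λ k d<k →
  ℤ.*-cancelˡ-≡ c (f k) 0ℤ (trans (sym (const-⊛ c f k)) (trans (vanish k d<k) (sym (ℤ.*-zeroʳ c))))

infix 4 _∣ₚ_
record _∣ₚ_ (f g : Series) : Set where
  constructor divides
  field
    quotient              : Series
    isPolynomial-quotient : IsPolynomial quotient
    equation              : g ≗ f ⊛ quotient

∣ₚ-respʳ-≗ : ∀ {f g g′} → g ≗ g′ → f ∣ₚ g → f ∣ₚ g′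
∣ₚ-respʳ-≗ g≗g′ (divides h poly g≗fh) = divides h poly (≗-trans (≗-sym g≗g′) g≗fh)

∣ₚ-⊛-inverse : ∀ {f f⁻¹ g} → f ⊛ f⁻¹ ≗ one → f ∣ₚ g → IsPolynomial (g ⊛ f⁻¹)
∣ₚ-⊛-inverse {f} {f⁻¹} {g} ff⁻¹≗1 (divides h poly g≗fh) = isPolynomial-cong (≗-sym g/f≗h) poly
  where
  open ≗-Reasoning
  g/f≗h : g ⊛ f⁻¹ ≗ h
  g/f≗h = begin
    g ⊛ f⁻¹          ≈⟨ ⊛-congʳ f⁻¹ g≗fh ⟩
    (f ⊛ h) ⊛ f⁻¹    ≈⟨ solve 3 (λ f h f⁻¹ → (f :* h) :* f⁻¹ := (f :* f⁻¹) :* h) ≗-refl f h f⁻¹ ⟩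
    (f ⊛ f⁻¹) ⊛ h    ≈⟨ ⊛-congʳ h ff⁻¹≗1 ⟩
    one ⊛ h          ≈⟨ ⊛-identityˡ h ⟩
    h                ∎

infix 4 _∈⟨_,_⟩
record _∈⟨_,_⟩ (h f g : Series) : Set where
  constructor combination
  field
    coefficientˡ coefficientʳ : Series
    isPolynomial-coefficientˡ : IsPolynomial coefficientˡ
    isPolynomial-coefficientʳ : IsPolynomial coefficientʳ
    equation                  : h ≗ coefficientˡ ⊛ f ⊕ coefficientʳ ⊛ g

∈⟨⟩-comm : ∀ {h f g} → h ∈⟨ f , g ⟩ → h ∈⟨ g , f ⟩
∈⟨⟩-comm {f = f} {g} (combination a b poly-a poly-b h≗af+bg) =
  combination b a poly-b poly-a (≗-trans h≗af+bg (CommutativeRing.+-comm seriesRing (a ⊛ f) (b ⊛ g)))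

∈⟨⟩-respˡ-≗ : ∀ {h f f′ g} → f ≗ f′ → h ∈⟨ f , g ⟩ → h ∈⟨ f′ , g ⟩
∈⟨⟩-respˡ-≗ {g = g} f≗f′ (combination a b poly-a poly-b h≗af+bg) =
  combination a b poly-a poly-b (≗-trans h≗af+bg (⊕-congʳ (b ⊛ g) (⊛-congˡ a f≗f′)))

∣ₚ-cancel : ∀ {c f g y} → const c ∈⟨ f , g ⟩ → IsPolynomial y → f ∣ₚ y ⊛ g → f ∣ₚ const c ⊛ y
∣ₚ-cancel {c} {f} {g} {y} (combination a b poly-a poly-b c≗af+bg) poly-y (divides h poly-h yg≗fh) =
  divides (a ⊛ y ⊕ b ⊛ h)
    (isPolynomial-⊕ (isPolynomial-⊛ poly-a poly-y) (isPolynomial-⊛ poly-b poly-h)) (begin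
    const c ⊛ y                  ≈⟨ ⊛-congʳ y c≗af+bg ⟩
    (a ⊛ f ⊕ b ⊛ g) ⊛ y          ≈⟨ expand a f b g y ⟩
    f ⊛ (a ⊛ y) ⊕ b ⊛ (y ⊛ g)    ≈⟨ ⊕-congˡ (f ⊛ (a ⊛ y)) (⊛-congˡ b yg≗fh) ⟩
    f ⊛ (a ⊛ y) ⊕ b ⊛ (f ⊛ h)    ≈⟨ collect f a y b h ⟩
    f ⊛ (a ⊛ y ⊕ b ⊛ h)          ∎)
  where
  open ≗-Reasoning
  expand : ∀ a f b g y → (a ⊛ f ⊕ b ⊛ g) ⊛ y ≗ f ⊛ (a ⊛ y) ⊕ b ⊛ (y ⊛ g)
  expand = solve 5 (λ a f b g y → (a :* f :+ b :* g) :* y := f :* (a :* y) :+ b :* (y :* g)) ≗-refl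
  collect : ∀ f a y b h → f ⊛ (a ⊛ y) ⊕ b ⊛ (f ⊛ h) ≗ f ⊛ (a ⊛ y ⊕ b ⊛ h)
  collect = solve 5 (λ f a y b h → f :* (a :* y) :+ b :* (f :* h) := f :* (a :* y :+ b :* h)) ≗-refl

∣ₚ-cancel-∏ₛ : ∀ n {c f y} {g : Fin n → Series} → (∀ j → const c ∈⟨ f , g j ⟩) → (∀ j → IsPolynomial (g j)) →
  IsPolynomial y → f ∣ₚ y ⊛ ∏ₛ n g → f ∣ₚ const (c ℤ.^ n) ⊛ y
∣ₚ-cancel-∏ₛ zero {y = y} _ _ _ f∣y = ∣ₚ-respʳ-≗ (≗-trans (⊛-identityʳ y) (≗-sym (⊛-identityˡ y))) f∣y
∣ₚ-cancel-∏ₛ (suc n) {c} {f} {y} {g} c∈⟨f,g⟩ poly-g poly-y f∣y·∏g = ∣ₚ-respʳ-≗ merge f∣c·cⁿy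
  where
  cⁿ : Series
  cⁿ = const (c ℤ.^ n)
  f∣yg₀·∏g : f ∣ₚ (y ⊛ g zero) ⊛ ∏ₛ n (g ∘ suc)
  f∣yg₀·∏g = ∣ₚ-respʳ-≗ (≗-sym (⊛-assoc y (g zero) (∏ₛ n (g ∘ suc)))) f∣y·∏g
  f∣cⁿy·g₀ : f ∣ₚ (cⁿ ⊛ y) ⊛ g zero
  f∣cⁿy·g₀ = ∣ₚ-respʳ-≗ (≗-sym (⊛-assoc cⁿ y (g zero)))
    (∣ₚ-cancel-∏ₛ n (c∈⟨f,g⟩ ∘ suc) (poly-g ∘ suc) (isPolynomial-⊛ poly-y (poly-g zero)) f∣yg₀·∏g)
  f∣c·cⁿy : f ∣ₚ const c ⊛ (cⁿ ⊛ y)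
  f∣c·cⁿy = ∣ₚ-cancel (c∈⟨f,g⟩ zero) (isPolynomial-⊛ (isPolynomial-const (c ℤ.^ n)) poly-y) f∣cⁿy·g₀
  merge : const c ⊛ (cⁿ ⊛ y) ≗ const (c ℤ.^ suc n) ⊛ y
  merge = ≗-trans (≗-sym (⊛-assoc (const c) cⁿ y)) (⊛-congʳ y (≗-sym (const-* c (c ℤ.^ n))))

oneMinusXPow-∣ₚ-const-⊝-geometricSum : ∀ p b → oneMinusXPow b ∣ₚ const (ℤ.+ p) ⊕ ⊝ geometricSum p b
oneMinusXPow-∣ₚ-const-⊝-geometricSum zero b = divides zeroₛ isPolynomial-zero λ k →
  trans (vanish k) (sym (sumUpTo-zero _ k (λ i _ → ℤ.*-zeroʳ (oneMinusXPow b i))))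
  where
  vanish : ∀ k → const 0ℤ k + - 0ℤ ≡ 0ℤ
  vanish zero    = refl
  vanish (suc k) = refl
oneMinusXPow-∣ₚ-const-⊝-geometricSum (suc p) b with oneMinusXPow-∣ₚ-const-⊝-geometricSum p b
... | divides h poly-h p-G≗Fh = divides (h ⊕ geometricSum p b)
  (isPolynomial-⊕ poly-h (isPolynomial-geometricSum p b)) (begin
    const (1ℤ + ℤ.+ p) ⊕ ⊝ (G ⊕ xPow (p ℕ.* b))
      ≈⟨ ⊕-congʳ (⊝ (G ⊕ xPow (p ℕ.* b))) (_-Raw-AlmostCommutative⟶_.+-homo constHomomorphism 1ℤ (ℤ.+ p)) ⟩
    (one ⊕ const (ℤ.+ p)) ⊕ ⊝ (G ⊕ xPow (p ℕ.* b))
      ≈⟨ regroup (const (ℤ.+ p)) G (xPow (p ℕ.* b)) ⟩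
    (const (ℤ.+ p) ⊕ ⊝ G) ⊕ oneMinusXPow (p ℕ.* b)
      ≈⟨ ⊕-cong p-G≗Fh (≗-sym (oneMinusXPow-⊛-geometricSum p b)) ⟩
    oneMinusXPow b ⊛ h ⊕ oneMinusXPow b ⊛ G
      ≈⟨ ⊛-distribˡ-⊕ (oneMinusXPow b) h G ⟨
    oneMinusXPow b ⊛ (h ⊕ G)
      ∎)
  where
  open ≗-Reasoning
  G = geometricSum p b
  regroup : ∀ c g x → (one ⊕ c) ⊕ ⊝ (g ⊕ x) ≗ (c ⊕ ⊝ g) ⊕ (one ⊕ ⊝ x)
  regroup = solve 3 (λ c g x → (con 1ℤ :+ c) :+ :- (g :+ x) := (c :+ :- g) :+ (con 1ℤ :+ :- x)) ≗-refl

oneMinusXPow-∈⟨⟩ : ∀ {a m c n} b → a ℕ.* m ≡ suc (c ℕ.* n) →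
  oneMinusXPow b ∈⟨ oneMinusXPow (m ℕ.* b) , oneMinusXPow (n ℕ.* b) ⟩
oneMinusXPow-∈⟨⟩ {a} {m} {c} {n} b am≡1+cn =
  combination (geometricSum a (m ℕ.* b)) (⊝ (xPow b ⊛ geometricSum c (n ℕ.* b)))
    (isPolynomial-geometricSum a (m ℕ.* b))
    (isPolynomial-⊝ (isPolynomial-⊛ (isPolynomial-xPow b) (isPolynomial-geometricSum c (n ℕ.* b)))) (begin
  Fb
    ≈⟨ cancel Fb Y ⟩
  (Fb ⊕ Y) ⊕ ⊝ Y
    ≈⟨ ⊕-congʳ (⊝ Y) (≗-sym (oneMinusXPow-+ b (c ℕ.* (n ℕ.* b)))) ⟩
  oneMinusXPow (b ℕ.+ c ℕ.* (n ℕ.* b)) ⊕ ⊝ Y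
    ≈⟨ ⊕-cong (≗-trans (oneMinusXPow-cong exponent) (≗-sym (oneMinusXPow-⊛-geometricSum a (m ℕ.* b))))
              (⊝-cong (⊛-congˡ (xPow b) (≗-sym (oneMinusXPow-⊛-geometricSum c (n ℕ.* b))))) ⟩
  Fm ⊛ Ga ⊕ ⊝ (xPow b ⊛ (Fn ⊛ Gc))
    ≈⟨ rearrange Fm Ga (xPow b) Fn Gc ⟩
  Ga ⊛ Fm ⊕ ⊝ (xPow b ⊛ Gc) ⊛ Fn
    ∎)
  where
  open ≗-Reasoning
  Fb = oneMinusXPow b
  Fm = oneMinusXPow (m ℕ.* b)
  Fn = oneMinusXPow (n ℕ.* b)
  Ga = geometricSum a (m ℕ.* b)
  Gc = geometricSum c (n ℕ.* b)
  Y = xPow b ⊛ oneMinusXPow (c ℕ.* (n ℕ.* b))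
  exponent : b ℕ.+ c ℕ.* (n ℕ.* b) ≡ a ℕ.* (m ℕ.* b)
  exponent = trans (cong (b ℕ.+_) (sym (ℕ.*-assoc c n b)))
    (trans (cong (ℕ._* b) (sym am≡1+cn)) (ℕ.*-assoc a m b))
  cancel : ∀ f y → f ≗ (f ⊕ y) ⊕ ⊝ y
  cancel = solve 2 (λ f y → f := (f :+ y) :+ :- y) ≗-refl
  rearrange : ∀ fm ga x fn gc → fm ⊛ ga ⊕ ⊝ (x ⊛ (fn ⊛ gc)) ≗ ga ⊛ fm ⊕ ⊝ (x ⊛ gc) ⊛ fn
  rearrange = solve 5 (λ fm ga x fn gc →
    fm :* ga :+ :- (x :* (fn :* gc)) := ga :* fm :+ :- (x :* gc) :* fn) ≗-refl

coprime⇒oneMinusXPow-∈⟨⟩ : ∀ {m n} b → Coprime m n →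
  oneMinusXPow b ∈⟨ oneMinusXPow (m ℕ.* b) , oneMinusXPow (n ℕ.* b) ⟩
coprime⇒oneMinusXPow-∈⟨⟩ {m} {n} b m⊥n with coprime-Bézout m⊥n
... | Bézout.+- x y 1+yn≡xm = oneMinusXPow-∈⟨⟩ {x} {m} {y} {n} b (sym 1+yn≡xm)
... | Bézout.-+ x y 1+xm≡yn = ∈⟨⟩-comm (oneMinusXPow-∈⟨⟩ {y} {n} {x} {m} b (sym 1+xm≡yn))

coprime⇒const-∈⟨⟩ : ∀ {p q} b → Coprime p q →
  const (ℤ.+ p) ∈⟨ oneMinusXPow (q ℕ.* b) , geometricSum p b ⟩
coprime⇒const-∈⟨⟩ {p} {q} b p⊥q
  with oneMinusXPow-∣ₚ-const-⊝-geometricSum p b | coprime⇒oneMinusXPow-∈⟨⟩ b (Coprime.sym p⊥q)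
... | divides h poly-h p-G≗Fh | combination u v poly-u poly-v Fb≗uFq+vFp =
  combination (h ⊛ u) (one ⊕ (v ⊛ Fb) ⊛ h) (isPolynomial-⊛ poly-h poly-u)
    (isPolynomial-⊕ (isPolynomial-const 1ℤ)
      (isPolynomial-⊛ (isPolynomial-⊛ poly-v (isPolynomial-oneMinusXPow b)) poly-h)) (begin
  const (ℤ.+ p)                      ≈⟨ cancel (const (ℤ.+ p)) G ⟩
  (const (ℤ.+ p) ⊕ ⊝ G) ⊕ G          ≈⟨ ⊕-congʳ G p-G≗Fh ⟩
  Fb ⊛ h ⊕ G                         ≈⟨ ⊕-congʳ G (⊛-congʳ h Fb≗uFq+vFp) ⟩
  (u ⊛ Fq ⊕ v ⊛ Fp) ⊛ h ⊕ G          ≈⟨ ⊕-congʳ G (⊛-congʳ h (⊕-congˡ (u ⊛ Fq) (⊛-congˡ v Fp≗FbG))) ⟩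
  (u ⊛ Fq ⊕ v ⊛ (Fb ⊛ G)) ⊛ h ⊕ G    ≈⟨ rearrange u Fq v Fb G h ⟩
  (h ⊛ u) ⊛ Fq ⊕ (one ⊕ (v ⊛ Fb) ⊛ h) ⊛ G ∎)
  where
  open ≗-Reasoning
  G  = geometricSum p b
  Fb = oneMinusXPow b
  Fp = oneMinusXPow (p ℕ.* b)
  Fq = oneMinusXPow (q ℕ.* b)
  Fp≗FbG : Fp ≗ Fb ⊛ G
  Fp≗FbG = ≗-sym (oneMinusXPow-⊛-geometricSum p b)
  cancel : ∀ c g → c ≗ (c ⊕ ⊝ g) ⊕ g
  cancel = solve 2 (λ c g → c := (c :+ :- g) :+ g) ≗-refl
  rearrange : ∀ u fq v fb g h → (u ⊛ fq ⊕ v ⊛ (fb ⊛ g)) ⊛ h ⊕ g ≗ (h ⊛ u) ⊛ fq ⊕ (one ⊕ (v ⊛ fb) ⊛ h) ⊛ g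
  rearrange = solve 6 (λ u fq v fb g h →
    (u :* fq :+ v :* (fb :* g)) :* h :+ g := (h :* u) :* fq :+ (con 1ℤ :+ v :* fb :* h) :* g) ≗-refl

^-nonZero : ∀ c n .{{_ : ℤ.NonZero c}} → ℤ.NonZero (c ℤ.^ n)
^-nonZero c zero    = _
^-nonZero c (suc n) = ℤ.i*j≢0 c (c ℤ.^ n)
  where instance cⁿ≢0 = ^-nonZero c n

∏ℕ-nonZero : ∀ n {p : Fin n → ℕ} → (∀ i → NonZero (p i)) → NonZero (∏ℕ n p)
∏ℕ-nonZero zero    _       = _
∏ℕ-nonZero (suc n) nonZero = ℕ.m*n≢0 _ _ {{nonZero zero}} {{∏ℕ-nonZero n (nonZero ∘ suc)}}

∣∏ℕ : ∀ n (p : Fin n → ℕ) i → p i ∣ ∏ℕ n p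
∣∏ℕ (suc n) p zero    = ∣m⇒∣m*n _ ∣-refl
∣∏ℕ (suc n) p (suc i) = ∣n⇒∣m*n (p zero) (∣∏ℕ n (p ∘ suc) i)

*-∣∏ℕ : ∀ n (p : Fin n → ℕ) {i j} → i ≢ j → p i ℕ.* p j ∣ ∏ℕ n p
*-∣∏ℕ (suc n) p {zero}  {zero}  0≢0 = ⊥-elim (0≢0 refl)
*-∣∏ℕ (suc n) p {zero}  {suc j} _   = *-monoʳ-∣ (p zero) (∣∏ℕ n (p ∘ suc) j)
*-∣∏ℕ (suc n) p {suc i} {zero}  _   =
  subst (_∣ ∏ℕ (suc n) p) (ℕ.*-comm (p zero) (p (suc i))) (*-monoʳ-∣ (p zero) (∣∏ℕ n (p ∘ suc) i))
*-∣∏ℕ (suc n) p {suc i} {suc j} i≢j = ∣n⇒∣m*n (p zero) (*-∣∏ℕ n (p ∘ suc) (i≢j ∘ cong suc))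

distinctPrimes⇒coprime : ∀ {a b} → Prime a → Prime b → a ≢ b → Coprime a b
distinctPrimes⇒coprime {a} {b} prime-a prime-b a≢b {d} (d∣a , d∣b) with prime⇒irreducible prime-a d∣a
... | inj₁ d≡1 = d≡1
... | inj₂ refl with prime⇒irreducible prime-b d∣b
...   | inj₁ a≡1 = ⊥-elim (ℕ.nonTrivial⇒≢1 {{prime⇒nonTrivial prime-a}} a≡1)
...   | inj₂ a≡b = ⊥-elim (a≢b a≡b)

bigN≡bigNᵢ*p : ∀ {n} (p : Fin n → ℕ) (pr : ∀ i → Prime (p i)) i → bigN p pr ≡ bigNᵢ p pr i ℕ.* p i
bigN≡bigNᵢ*p {n} p pr i = sym (m/n*n≡m {{prime⇒nonZero (pr i)}} (∣∏ℕ n p i))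

module _ {n : ℕ} (p : Fin (suc n) → ℕ) (pr : ∀ i → Prime (p i)) where

  private
    p′ : Fin n → ℕ
    p′ = p ∘ suc
    pr′ : ∀ i → Prime (p′ i)
    pr′ = pr ∘ suc
    instance
      p-nonZero : ∀ {i} → NonZero (p i)
      p-nonZero {i} = prime⇒nonZero (pr i)

  bigNᵢ-zero : bigNᵢ p pr zero ≡ bigN p′ pr′
  bigNᵢ-zero = trans (/-congˡ (ℕ.*-comm (p zero) (bigN p′ pr′))) (m*n/n≡m (bigN p′ pr′) (p zero))

  bigNᵢ-suc : ∀ j → bigNᵢ p pr (suc j) ≡ p zero ℕ.* bigNᵢ p′ pr′ j
  bigNᵢ-suc j = *-/-assoc (p zero) (∣∏ℕ n p′ j)

  bigNᵢⱼ-zero-suc : ∀ j → bigNᵢⱼ p pr zero (suc j) ≡ bigNᵢ p′ pr′ j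
  bigNᵢⱼ-zero-suc j = m*n/m*o≡n/o (p zero) (bigN p′ pr′) (p′ j) {{_}} {{ℕ.m*n≢0 (p zero) (p′ j)}}

  bigNᵢⱼ-suc-suc : ∀ {i j} → i ≢ j → bigNᵢⱼ p pr (suc i) (suc j) ≡ p zero ℕ.* bigNᵢⱼ p′ pr′ i j
  bigNᵢⱼ-suc-suc {i} {j} i≢j = *-/-assoc (p zero) {{ℕ.m*n≢0 (p′ i) (p′ j)}} (*-∣∏ℕ n p′ i≢j)

record IsPolynomialQuotient (num den : Series) : Set where
  constructor polynomialQuotient
  field
    quotient              : Series
    isPolynomial-quotient : IsPolynomial quotient
    equation              : quotient ⊛ den ≗ num

IsPolynomialQuotient-cong : ∀ {num num′ den den′} → num ≗ num′ → den ≗ den′ →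
  IsPolynomialQuotient num den → IsPolynomialQuotient num′ den′
IsPolynomialQuotient-cong num≗num′ den≗den′ (polynomialQuotient Q poly-Q Q·den≗num) =
  polynomialQuotient Q poly-Q (≗-trans (⊛-congˡ Q (≗-sym den≗den′)) (≗-trans Q·den≗num num≗num′))

-- The quotient is Q E f⁻¹; it is a polynomial because c times it is, and c ≠ 0 cancels coefficientwise.
IsPolynomialQuotient-⊛ : ∀ {f num den E} f⁻¹ c .{{_ : ℤ.NonZero c}} → f ⊛ f⁻¹ ≗ one →
  (q : IsPolynomialQuotient num den) → f ∣ₚ const c ⊛ (IsPolynomialQuotient.quotient q ⊛ E) →
  IsPolynomialQuotient (num ⊛ E) (f ⊛ den)
IsPolynomialQuotient-⊛ {f} {num} {den} {E} f⁻¹ c ff⁻¹≗1 (polynomialQuotient Q poly-Q Q·den≗num) f∣cQE =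
  polynomialQuotient ((Q ⊛ E) ⊛ f⁻¹)
    (isPolynomial-const-⊛⁻¹ c
      (isPolynomial-cong (⊛-assoc (const c) (Q ⊛ E) f⁻¹) (∣ₚ-⊛-inverse {f⁻¹ = f⁻¹} ff⁻¹≗1 f∣cQE))) (begin
    ((Q ⊛ E) ⊛ f⁻¹) ⊛ (f ⊛ den)   ≈⟨ regroup Q E f⁻¹ f den ⟩
    ((Q ⊛ den) ⊛ E) ⊛ (f ⊛ f⁻¹)   ≈⟨ ⊛-cong (⊛-congʳ E Q·den≗num) ff⁻¹≗1 ⟩
    (num ⊛ E) ⊛ one               ≈⟨ ⊛-identityʳ (num ⊛ E) ⟩
    num ⊛ E                       ∎)
  where
  open ≗-Reasoning
  regroup : ∀ q e g f d → ((q ⊛ e) ⊛ g) ⊛ (f ⊛ d) ≗ ((q ⊛ d) ⊛ e) ⊛ (f ⊛ g)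
  regroup = solve 5 (λ q e g f d → ((q :* e) :* g) :* (f :* d) := ((q :* d) :* e) :* (f :* g)) ≗-refl

module _ (m : ℕ) {n : ℕ} (p : Fin n → ℕ) (pr : ∀ i → Prime (p i)) where

  scaledDenominator : Series
  scaledDenominator = ∏ₛ n (λ i → oneMinusXPow (m ℕ.* bigNᵢ p pr i))

  scaledPairProduct : Series
  scaledPairProduct = ∏ₛ n (λ i → ∏ₛ n (λ j →
    if toℕ i <ᵇ toℕ j then oneMinusXPow (m ℕ.* bigNᵢⱼ p pr i j) else one))

  scaledNumerator : Series
  scaledNumerator = oneMinusXPow (m ℕ.* bigN p pr) ⊛ scaledPairProduct

if-oneMinusXPow-cong : ∀ (c : Bool) {a b} → (T c → a ≡ b) →
  (if c then oneMinusXPow a else one) ≗ (if c then oneMinusXPow b else one)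
if-oneMinusXPow-cong true  a≡b = oneMinusXPow-cong (a≡b tt)
if-oneMinusXPow-cong false _   = ≗-refl

isPolynomial-scaledPairProduct : ∀ m {n} (p : Fin n → ℕ) pr → IsPolynomial (scaledPairProduct m p pr)
isPolynomial-scaledPairProduct m {n} p pr =
  isPolynomial-∏ₛ n λ i → isPolynomial-∏ₛ n λ j → pairFactor (toℕ i <ᵇ toℕ j)
  where
  pairFactor : ∀ c {a} → IsPolynomial (if c then oneMinusXPow a else one)
  pairFactor true  = isPolynomial-oneMinusXPow _
  pairFactor false = isPolynomial-const 1ℤ

scaledDenominator-⊛-geometricSums : ∀ m c {n} (p : Fin n → ℕ) pr →
  scaledDenominator m p pr ⊛ ∏ₛ n (λ j → geometricSum c (m ℕ.* bigNᵢ p pr j))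
    ≗ scaledDenominator (m ℕ.* c) p pr
scaledDenominator-⊛-geometricSums m c {n} p pr = ≗-trans (≗-sym (∏ₛ-⊛ n _ _)) (∏ₛ-cong n λ j →
    ≗-trans (oneMinusXPow-⊛-geometricSum c (m ℕ.* bigNᵢ p pr j))
            (oneMinusXPow-cong (rearrange m c (bigNᵢ p pr j))))
  where
  rearrange : ∀ m c x → c ℕ.* (m ℕ.* x) ≡ m ℕ.* c ℕ.* x
  rearrange = ℕ-solve-∀

oneMinusXPow-∣ₚ-scaledNumerator : ∀ m c {n} (p : Fin n → ℕ) pr →
  oneMinusXPow (m ℕ.* bigN p pr) ∣ₚ scaledNumerator (m ℕ.* c) p pr
oneMinusXPow-∣ₚ-scaledNumerator m c p pr =
  divides (G ⊛ R)
    (isPolynomial-⊛ (isPolynomial-geometricSum c mN) (isPolynomial-scaledPairProduct (m ℕ.* c) p pr))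
    (begin
      oneMinusXPow (m ℕ.* c ℕ.* bigN p pr) ⊛ R  ≈⟨ ⊛-congʳ R (oneMinusXPow-cong (rearrange m c (bigN p pr))) ⟩
      oneMinusXPow (c ℕ.* mN) ⊛ R               ≈⟨ ⊛-congʳ R (oneMinusXPow-⊛-geometricSum c mN) ⟨
      (oneMinusXPow mN ⊛ G) ⊛ R                 ≈⟨ ⊛-assoc (oneMinusXPow mN) G R ⟩
      oneMinusXPow mN ⊛ (G ⊛ R)                 ∎)
  where
  open ≗-Reasoning
  mN = m ℕ.* bigN p pr
  G = geometricSum c mN
  R = scaledPairProduct (m ℕ.* c) p pr
  rearrange : ∀ m c x → m ℕ.* c ℕ.* x ≡ c ℕ.* (m ℕ.* x)
  rearrange = ℕ-solve-∀

module _ (m : ℕ) {n : ℕ} (p : Fin (suc n) → ℕ) (pr : ∀ i → Prime (p i)) where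

  private
    p′ : Fin n → ℕ
    p′ = p ∘ suc
    pr′ : ∀ i → Prime (p′ i)
    pr′ = pr ∘ suc
    reassoc : ∀ x → m ℕ.* (p zero ℕ.* x) ≡ m ℕ.* p zero ℕ.* x
    reassoc x = sym (ℕ.*-assoc m (p zero) x)

  scaledDenominator-suc :
    scaledDenominator m p pr ≗ oneMinusXPow (m ℕ.* bigN p′ pr′) ⊛ scaledDenominator (m ℕ.* p zero) p′ pr′
  scaledDenominator-suc = ⊛-cong (oneMinusXPow-cong (cong (m ℕ.*_) (bigNᵢ-zero p pr)))
    (∏ₛ-cong n λ j → oneMinusXPow-cong (trans (cong (m ℕ.*_) (bigNᵢ-suc p pr j)) (reassoc _)))

  scaledPairProduct-suc :
    scaledPairProduct m p pr ≗ scaledDenominator m p′ pr′ ⊛ scaledPairProduct (m ℕ.* p zero) p′ pr′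
  scaledPairProduct-suc = ⊛-cong firstRow (∏ₛ-cong n otherRows)
    where
    firstRow = ≗-trans (⊛-identityˡ _)
      (∏ₛ-cong n λ j → oneMinusXPow-cong (cong (m ℕ.*_) (bigNᵢⱼ-zero-suc p pr j)))
    otherRows = λ i → ≗-trans (⊛-identityˡ _) (∏ₛ-cong n λ j → if-oneMinusXPow-cong (toℕ i <ᵇ toℕ j) λ i<j →
      trans (cong (m ℕ.*_) (bigNᵢⱼ-suc-suc p pr (<ᵇ⇒≢ i<j))) (reassoc _))
      where
      <ᵇ⇒≢ : ∀ {i j} → T (toℕ i <ᵇ toℕ j) → i ≢ j
      <ᵇ⇒≢ {i} {j} i<j refl = ℕ.<-irrefl refl (ℕ.<ᵇ⇒< (toℕ i) (toℕ j) i<j)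

  scaledNumerator-suc :
    scaledNumerator m p pr ≗ scaledNumerator (m ℕ.* p zero) p′ pr′ ⊛ scaledDenominator m p′ pr′
  scaledNumerator-suc = begin
    oneMinusXPow (m ℕ.* (p zero ℕ.* bigN p′ pr′)) ⊛ scaledPairProduct m p pr
      ≈⟨ ⊛-cong (oneMinusXPow-cong (reassoc (bigN p′ pr′))) scaledPairProduct-suc ⟩
    F ⊛ (D ⊛ R)
      ≈⟨ solve 3 (λ F D R → F :* (D :* R) := (F :* R) :* D) ≗-refl F D R ⟩
    (F ⊛ R) ⊛ D
      ∎
    where
    open ≗-Reasoning
    F = oneMinusXPow (m ℕ.* p zero ℕ.* bigN p′ pr′)
    D = scaledDenominator m p′ pr′
    R = scaledPairProduct (m ℕ.* p zero) p′ pr′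

  const-p₀-∈⟨⟩ : Injective _≡_ _≡_ p → ∀ j →
    const (ℤ.+ (p zero)) ∈⟨ oneMinusXPow (m ℕ.* bigN p′ pr′) , geometricSum (p zero) (m ℕ.* bigNᵢ p′ pr′ j) ⟩
  const-p₀-∈⟨⟩ injective j = ∈⟨⟩-respˡ-≗ (oneMinusXPow-cong exponent)
    (coprime⇒const-∈⟨⟩ (m ℕ.* bigNᵢ p′ pr′ j)
      (distinctPrimes⇒coprime (pr zero) (pr (suc j)) (Fin.0≢1+n ∘ injective)))
    where
    rearrange : ∀ q m x → q ℕ.* (m ℕ.* x) ≡ m ℕ.* (x ℕ.* q)
    rearrange = ℕ-solve-∀
    exponent : p′ j ℕ.* (m ℕ.* bigNᵢ p′ pr′ j) ≡ m ℕ.* bigN p′ pr′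
    exponent = trans (rearrange (p′ j) m (bigNᵢ p′ pr′ j)) (cong (m ℕ.*_) (sym (bigN≡bigNᵢ*p p′ pr′ j)))

scaledQuotient-isPolynomial : ∀ n m .{{_ : NonZero m}} (p : Fin n → ℕ) (pr : ∀ i → Prime (p i)) →
  Injective _≡_ _≡_ p → IsPolynomialQuotient (scaledNumerator m p pr) (scaledDenominator m p pr)
scaledQuotient-isPolynomial zero m p pr _ = polynomialQuotient (scaledNumerator m p pr)
  (isPolynomial-⊛ (isPolynomial-oneMinusXPow (m ℕ.* 1)) (isPolynomial-const 1ℤ))
  (⊛-identityʳ (scaledNumerator m p pr))
scaledQuotient-isPolynomial (suc n) m p pr injective =
  IsPolynomialQuotient-cong (≗-sym (scaledNumerator-suc m p pr)) (≗-sym (scaledDenominator-suc m p pr)) step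
  where
  p′ = p ∘ suc
  pr′ = pr ∘ suc
  M = bigN p′ pr′
  E = scaledDenominator m p′ pr′
  G : Fin n → Series
  G j = geometricSum (p zero) (m ℕ.* bigNᵢ p′ pr′ j)
  instance
    p₀≢0 : NonZero (p zero)
    p₀≢0 = prime⇒nonZero (pr zero)
    mp₀≢0 : NonZero (m ℕ.* p zero)
    mp₀≢0 = ℕ.m*n≢0 m (p zero)
    M≢0 : NonZero M
    M≢0 = ∏ℕ-nonZero n (λ i → prime⇒nonZero (pr′ i))
    mM≢0 : NonZero (m ℕ.* M)
    mM≢0 = ℕ.m*n≢0 m M
  IH = scaledQuotient-isPolynomial n (m ℕ.* p zero) p′ pr′ (Fin.suc-injective ∘ injective)
  open IsPolynomialQuotient IH
    renaming (quotient to Q′; isPolynomial-quotient to poly-Q′; equation to Q′·den′≗num′)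
  cleared : (Q′ ⊛ E) ⊛ ∏ₛ n G ≗ scaledNumerator (m ℕ.* p zero) p′ pr′
  cleared = ≗-trans (⊛-assoc Q′ E (∏ₛ n G))
    (≗-trans (⊛-congˡ Q′ (scaledDenominator-⊛-geometricSums m (p zero) p′ pr′)) Q′·den′≗num′)
  divisibility : oneMinusXPow (m ℕ.* M) ∣ₚ const ((ℤ.+ (p zero)) ℤ.^ n) ⊛ (Q′ ⊛ E)
  divisibility = ∣ₚ-cancel-∏ₛ n (const-p₀-∈⟨⟩ m p pr injective) (λ j → isPolynomial-geometricSum (p zero) _)
    (isPolynomial-⊛ poly-Q′ (isPolynomial-∏ₛ n (λ j → isPolynomial-oneMinusXPow _)))
    (∣ₚ-respʳ-≗ (≗-sym cleared) (oneMinusXPow-∣ₚ-scaledNumerator m (p zero) p′ pr′))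
  step : IsPolynomialQuotient (scaledNumerator (m ℕ.* p zero) p′ pr′ ⊛ E)
                              (oneMinusXPow (m ℕ.* M) ⊛ scaledDenominator (m ℕ.* p zero) p′ pr′)
  step = IsPolynomialQuotient-⊛ {E = E} (geometricSeries (m ℕ.* M))
    ((ℤ.+ (p zero)) ℤ.^ n) {{^-nonZero (ℤ.+ (p zero)) n}}
    (oneMinusXPow-⊛-geometricSeries (m ℕ.* M)) IH divisibility

module _ {n : ℕ} (p : Fin n → ℕ) (pr : ∀ i → Prime (p i)) where

  scaledNumerator-1 : scaledNumerator 1 p pr ≗ numerator p pr
  scaledNumerator-1 = ⊛-cong (oneMinusXPow-cong (ℕ.*-identityˡ (bigN p pr)))
    (∏ₛ-cong n λ i → ∏ₛ-cong n λ j →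
      if-oneMinusXPow-cong (toℕ i <ᵇ toℕ j) λ _ → ℕ.*-identityˡ (bigNᵢⱼ p pr i j))

  scaledDenominator-1 : scaledDenominator 1 p pr ≗ denominator p pr
  scaledDenominator-1 = ∏ₛ-cong n λ i → oneMinusXPow-cong (ℕ.*-identityˡ (bigNᵢ p pr i))

mainTheorem4 : (n : ℕ) → 2 ≤ n → (p : Fin n → ℕ) → (pr : ∀ i → Prime (p i)) →
    Injective _≡_ _≡_ p → PNIsIntegerPolynomial p pr
mainTheorem4 n _ p pr injective = Q , poly-Q , Q·den≗num
  where
  open IsPolynomialQuotient
    (IsPolynomialQuotient-cong (scaledNumerator-1 p pr) (scaledDenominator-1 p pr)
      (scaledQuotient-isPolynomial n 1 p pr injective))
    renaming (quotient to Q; isPolynomial-quotient to poly-Q; equation to Q·den≗num)
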